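{- Let $f:\{0,1\}^n\to\{0,1\}$ and $J\subseteq[n]$, and let $f_J$ be a $J$-symmetric function closest to $f$. Then $$\mathrm{dist}(f,f_J)\le\mathrm{SymInf}_f(J)\le 2\cdot\mathrm{dist}(f,f_J).$$
   Context: $\mathcal{S}_J$ is the set of permutations of $[n]$ fixing every element outside $J$; $\pi x$ is the vector whose $\pi(i)$-th coordinate is $x_i$. $f$ is $J$-symmetric if $f(\pi x)=f(x)$ for all $x$ and $\pi\in\mathcal{S}_J$. $\mathrm{dist}(f,g)=\Pr_x[f(x)\ne g(x)]$ for uniform $x$. The symmetric influence is $\mathrm{SymInf}_f(J)=\Pr_{x,\pi}[f(x)\ne f(\pi x)]$ with $x$ uniform in $\{0,1\}^n$ and $\pi$ uniform in $\mathcal{S}_J$, independently. -}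

module Defs where

open import Data.Nat using (ℕ; zero; suc; _≤_)
open import Data.Bool using (Bool; true; false; _∧_) renaming (_≟_ to _≟ᵇ_)
open import Data.Fin using (Fin) renaming (_≟_ to _≟ᶠ_)
open import Data.Fin.Properties using (all?)
open import Data.Fin.Subset using (Subset; _∉_)
open import Data.Fin.Subset.Properties using (_∈?_)
open import Data.Vec using (Vec; []; _∷_; lookup; tabulate)
open import Data.List using (List; []; _∷_; map; _++_; length; filter; cartesianProduct; allFin; concatMap)
open import Data.Bool.ListAction using (any)
open import Data.Product using (_×_; _,_; proj₁; proj₂)
open import Relation.Binary.PropositionalEquality using (_≡_)
open import Relation.Nullary using (¬_; Dec; ¬?; does)
open import Relation.Nullary.Decidable using (_×-dec_; _→-dec_)

cube : (n : ℕ) → List (Vec Bool n)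
cube zero    = [] ∷ []
cube (suc n) = map (false ∷_) (cube n) ++ map (true ∷_) (cube n)

vecsOver : {A : Set} → List A → (k : ℕ) → List (Vec A k)
vecsOver as zero    = [] ∷ []
vecsOver as (suc k) = concatMap (λ a → map (a ∷_) (vecsOver as k)) as

-- A map π : [n] → [n] is represented by its table (π(i) = lookup π i).
-- IsSJ J π : π is a permutation of [n] (injective self-map of a finite set)
-- fixing every element outside J, i.e. π ∈ S_J.
IsSJ : {n : ℕ} → Subset n → Vec (Fin n) n → Set
IsSJ {n} J π =
  ((i j : Fin n) → lookup π i ≡ lookup π j → i ≡ j) ×
  ((i : Fin n) → i ∉ J → lookup π i ≡ i)

IsSJ? : {n : ℕ} (J : Subset n) (π : Vec (Fin n) n) → Dec (IsSJ J π)
IsSJ? J π =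
  all? (λ i → all? (λ j → (lookup π i ≟ᶠ lookup π j) →-dec (i ≟ᶠ j)))
  ×-dec all? (λ i → ¬? (i ∈? J) →-dec (lookup π i ≟ᶠ i))

SJ : {n : ℕ} → Subset n → List (Vec (Fin n) n)
SJ {n} J = filter (IsSJ? J) (vecsOver (allFin n) n)

-- π x : the vector whose π(i)-th coordinate is x_i, i.e. its j-th coordinate
-- is x_i for the (unique, as π is a bijection) i with π(i) = j.
act : {n : ℕ} → Vec (Fin n) n → Vec Bool n → Vec Bool n
act {n} π x = tabulate (λ j → any (λ i → does (lookup π i ≟ᶠ j) ∧ lookup x i) (allFin n))

IsJSymmetric : {n : ℕ} → Subset n → (Vec Bool n → Bool) → Set
IsJSymmetric {n} J f = (x : Vec Bool n) (π : Vec (Fin n) n) → IsSJ J π → f (act π x) ≡ f x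

-- distCount f g = 2^n · dist(f,g) = #{x : f x ≠ g x}.
distCount : {n : ℕ} → (Vec Bool n → Bool) → (Vec Bool n → Bool) → ℕ
distCount {n} f g = length (filter (λ x → ¬? (f x ≟ᵇ g x)) (cube n))

-- symInfCount f J = 2^n · |S_J| · SymInf_f(J) = #{(x,π) ∈ {0,1}^n × S_J : f x ≠ f (π x)}.
symInfCount : {n : ℕ} → (Vec Bool n → Bool) → Subset n → ℕ
symInfCount {n} f J =
  length (filter (λ p → ¬? (f (proj₁ p) ≟ᵇ f (act (proj₂ p) (proj₁ p))))
                 (cartesianProduct (cube n) (SJ J)))

sizeSJ : {n : ℕ} → Subset n → ℕ
sizeSJ J = length (SJ J)

module Submission where

-- Write C = {0,1}^n and S = S_J.  Each π ∈ S permutes C, so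
-- summing the orbit sums x ↦ ∑_{π ∈ S} g (π x) over C gives |S| · ∑_C g; and
-- right multiplication by σ ∈ S permutes S, so orbit sums are J-symmetric.
-- Upper bound: for a J-symmetric g, [f x ≠ f (π x)] ≤ [f x ≠ g x] + [f (π x) ≠ g (π x)];
-- summing gives SymInf ≤ 2 |S| dist(f, g), in particular for g = f_J.
-- Lower bound: the orbit-wise majority vote of f is J-symmetric (it depends only
-- on orbit sums), and it disagrees with f (π x) no more often than f x does, so
-- |S| dist(f, majority) ≤ SymInf; minimality of f_J finishes.

open import Defs
open import Data.Nat using (ℕ; zero; suc; _+_; _*_; _≤_; _≤?_; z≤n; s≤s)
open import Data.Nat.Properties
  using ( ≤-refl; ≤-trans; <⇒≤; ≰⇒>; n<1+n; +-mono-≤; *-monoˡ-≤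
        ; +-identityʳ; *-zeroʳ; *-comm; +-commutativeSemigroup; module ≤-Reasoning)
open import Data.Nat.ListAction using (sum)
open import Data.Nat.ListAction.Properties using (sum-++; sum-↭)
open import Data.Bool using (Bool; true; false; _∧_) renaming (_≟_ to _≟ᵇ_)
open import Data.Bool.ListAction using (any)
open import Data.Bool.Properties using (∨-zeroʳ)
open import Data.Fin using (Fin; punchOut) renaming (_≟_ to _≟ᶠ_)
open import Data.Fin.Subset using (Subset)
open import Data.Fin.Properties using (any?; punchOut-injective; <⇒notInjective)
open import Data.Vec using (Vec; []; _∷_; lookup; tabulate)
open import Data.Vec.Properties using (∷-injective; lookup∘tabulate; tabulate∘lookup; tabulate-cong)
open import Data.List
  using (List; []; _∷_; map; _++_; length; filter; allFin; concatMap; cartesianProduct; cartesianProductWith)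
open import Data.List.Properties using (map-++; map-∘; ++-identityʳ)
open import Data.List.Membership.Propositional using (_∈_)
open import Data.List.Membership.Propositional.Properties
  using (∈-map⁺; ∈-map⁻; ∈-cartesianProductWith⁺; ∈-allFin; ∈-filter⁺; ∈-filter⁻)
open import Data.List.Membership.Propositional.Properties.WithK using (unique∧set⇒bag)
open import Data.List.Relation.Binary.BagAndSetEquality using (_∼[_]_; bag; ∼bag⇒↭)
open import Data.List.Relation.Binary.Permutation.Propositional.Properties
  using () renaming (map⁺ to ↭-map⁺)
open import Data.List.Relation.Unary.Any using (here; there)
open import Data.List.Relation.Unary.AllPairs using ([]; _∷_)
open import Data.List.Relation.Unary.All using ([]; _∷_)
open import Data.List.Relation.Unary.Unique.Propositional using (Unique)
import Data.List.Relation.Unary.Unique.Propositional.Properties as Unique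
open import Data.Product using (_×_; _,_; proj₁; proj₂; ∃)
open import Data.Empty using (⊥-elim)
open import Function using (_∘_)
open import Function.Definitions using (Injective)
open import Function.Bundles using (mk⇔)
open import Relation.Binary.PropositionalEquality
open import Relation.Nullary using (Dec; ¬?; does; yes; no)
open import Relation.Nullary.Decidable using (dec-true; dec-false)
open import Relation.Binary.Definitions using (DecidableEquality)
open import Algebra.Properties.CommutativeSemigroup +-commutativeSemigroup
  using (interchange)
open import Relation.Unary using (Decidable)

χ : Bool → ℕ
χ true  = 1
χ false = 0

module _ {A : Set} where

  ∑ : List A → (A → ℕ) → ℕ
  ∑ L g = sum (map g L)

  ∑-cong : (L : List A) {g h : A → ℕ} → (∀ {a} → a ∈ L → g a ≡ h a) → ∑ L g ≡ ∑ L h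
  ∑-cong []      g≡h = refl
  ∑-cong (a ∷ L) g≡h = cong₂ _+_ (g≡h (here refl)) (∑-cong L (g≡h ∘ there))

  ∑-mono : (L : List A) {g h : A → ℕ} → (∀ {a} → a ∈ L → g a ≤ h a) → ∑ L g ≤ ∑ L h
  ∑-mono []      g≤h = z≤n
  ∑-mono (a ∷ L) g≤h = +-mono-≤ (g≤h (here refl)) (∑-mono L (g≤h ∘ there))

  ∑-+ : (L : List A) (g h : A → ℕ) → ∑ L (λ a → g a + h a) ≡ ∑ L g + ∑ L h
  ∑-+ []      g h = refl
  ∑-+ (a ∷ L) g h =
    trans (cong ((g a + h a) +_) (∑-+ L g h)) (interchange (g a) (h a) (∑ L g) (∑ L h))

  ∑-const : (L : List A) (c : ℕ) → ∑ L (λ _ → c) ≡ length L * c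
  ∑-const []      c = refl
  ∑-const (a ∷ L) c = cong (c +_) (∑-const L c)

  ∑-++ : (L M : List A) (g : A → ℕ) → ∑ (L ++ M) g ≡ ∑ L g + ∑ M g
  ∑-++ L M g = trans (cong sum (map-++ g L M)) (sum-++ (map g L) (map g M))

  length-filter : {P : A → Set} (P? : Decidable P) (L : List A) →
    length (filter P? L) ≡ ∑ L (λ a → χ (does (P? a)))
  length-filter P? []      = refl
  length-filter P? (a ∷ L) with does (P? a)
  ... | true  = cong suc (length-filter P? L)
  ... | false = length-filter P? L

∑-map : {A B : Set} (h : A → B) (L : List A) (g : B → ℕ) → ∑ (map h L) g ≡ ∑ L (g ∘ h)
∑-map h L g = cong sum (sym (map-∘ L))

∑-swap : {A B : Set} (L : List A) (M : List B) (g : A → B → ℕ) →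
  ∑ L (λ a → ∑ M (g a)) ≡ ∑ M (λ b → ∑ L (λ a → g a b))
∑-swap []      M g = sym (trans (∑-const M 0) (*-zeroʳ (length M)))
∑-swap (a ∷ L) M g =
  trans (cong (∑ M (g a) +_) (∑-swap L M g)) (sym (∑-+ M (g a) (λ b → ∑ L (λ a → g a b))))

∑-cartesianProduct : {A B : Set} (L : List A) (M : List B) (g : A × B → ℕ) →
  ∑ (cartesianProduct L M) g ≡ ∑ L (λ a → ∑ M (λ b → g (a , b)))
∑-cartesianProduct []      M g = refl
∑-cartesianProduct (a ∷ L) M g = begin
  ∑ (map (a ,_) M ++ cartesianProduct L M) g
    ≡⟨ ∑-++ (map (a ,_) M) _ g ⟩
  ∑ (map (a ,_) M) g + ∑ (cartesianProduct L M) g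
    ≡⟨ cong₂ _+_ (∑-map (a ,_) M g) (∑-cartesianProduct L M g) ⟩
  ∑ M (λ b → g (a , b)) + ∑ L (λ a → ∑ M (λ b → g (a , b))) ∎
  where open ≡-Reasoning

∑-reindex : {A : Set} (L : List A) → Unique L → (φ ψ : A → A) →
  (∀ {a} → a ∈ L → φ a ∈ L) → (∀ {a} → a ∈ L → ψ a ∈ L) →
  (∀ a → ψ (φ a) ≡ a) → (∀ {a} → a ∈ L → φ (ψ a) ≡ a) →
  (g : A → ℕ) → ∑ L (g ∘ φ) ≡ ∑ L g
∑-reindex L L-unique φ ψ φ∈ ψ∈ ψφ φψ g =
  trans (sym (∑-map φ L g)) (sum-↭ (↭-map⁺ g (∼bag⇒↭ φL∼L)))
  where
  φ-injective : ∀ {a b} → φ a ≡ φ b → a ≡ b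
  φ-injective {a} {b} e = trans (sym (ψφ a)) (trans (cong ψ e) (ψφ b))

  into : ∀ {a} → a ∈ map φ L → a ∈ L
  into a∈ with b , b∈ , refl ← ∈-map⁻ φ a∈ = φ∈ b∈

  onto : ∀ {a} → a ∈ L → a ∈ map φ L
  onto a∈ = subst (_∈ map φ L) (φψ a∈) (∈-map⁺ φ (ψ∈ a∈))

  φL∼L : map φ L ∼[ bag ] L
  φL∼L = unique∧set⇒bag (Unique.map⁺ φ-injective L-unique) L-unique (mk⇔ into onto)

-- differ a b is 1 if a ≠ b and 0 otherwise, in the form in which the
-- filters of distCount and symInfCount test disagreement.
differ : Bool → Bool → ℕ
differ a b = χ (does (¬? (a ≟ᵇ b)))

differ-sym : ∀ a b → differ a b ≡ differ b a
differ-sym false false = refl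
differ-sym false true  = refl
differ-sym true  false = refl
differ-sym true  true  = refl

differ-triangle : ∀ a b c → differ a b ≤ differ a c + differ b c
differ-triangle false false c     = z≤n
differ-triangle true  true  c     = z≤n
differ-triangle false true  false = ≤-refl
differ-triangle false true  true  = s≤s z≤n
differ-triangle true  false false = s≤s z≤n
differ-triangle true  false true  = ≤-refl

bool-argmin : (g : Bool → ℕ) (t≤f? : Dec (g true ≤ g false)) (c : Bool) → g (does t≤f?) ≤ g c
bool-argmin g (yes _)   true  = ≤-refl
bool-argmin g (yes t≤f) false = t≤f
bool-argmin g (no  t≰f) true  = <⇒≤ (≰⇒> t≰f)
bool-argmin g (no  _)   false = ≤-refl

module _ {A : Set} where

  vecsOver-suc : (as : List A) (k : ℕ) →
    vecsOver as (suc k) ≡ cartesianProductWith _∷_ as (vecsOver as k)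
  vecsOver-suc as k = prepend-all as
    where
    prepend-all : (bs : List A) →
      concatMap (λ b → map (b ∷_) (vecsOver as k)) bs ≡ cartesianProductWith _∷_ bs (vecsOver as k)
    prepend-all []       = refl
    prepend-all (b ∷ bs) = cong (map (b ∷_) (vecsOver as k) ++_) (prepend-all bs)

  vecsOver-complete : {as : List A} → (∀ a → a ∈ as) → (k : ℕ) (v : Vec A k) → v ∈ vecsOver as k
  vecsOver-complete as-complete zero    []      = here refl
  vecsOver-complete {as} as-complete (suc k) (a ∷ v) =
    subst (a ∷ v ∈_) (sym (vecsOver-suc as k))
      (∈-cartesianProductWith⁺ _∷_ (as-complete a) (vecsOver-complete as-complete k v))

  vecsOver-unique : {as : List A} → Unique as → (k : ℕ) → Unique (vecsOver as k)
  vecsOver-unique as-unique zero    = [] ∷ []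
  vecsOver-unique {as} as-unique (suc k) =
    subst Unique (sym (vecsOver-suc as k))
      (Unique.cartesianProductWith⁺ _∷_ ∷-injective as-unique (vecsOver-unique as-unique k))

cube≡vecsOver : (n : ℕ) → cube n ≡ vecsOver (false ∷ true ∷ []) n
cube≡vecsOver zero    = refl
cube≡vecsOver (suc n) rewrite cube≡vecsOver n =
  cong (map (false ∷_) (vecsOver bits n) ++_) (sym (++-identityʳ (map (true ∷_) (vecsOver bits n))))
  where
  bits : List Bool
  bits = false ∷ true ∷ []

cube-complete : (n : ℕ) (x : Vec Bool n) → x ∈ cube n
cube-complete n x = subst (x ∈_) (sym (cube≡vecsOver n)) (vecsOver-complete every-bit n x)
  where
  every-bit : ∀ b → b ∈ false ∷ true ∷ []
  every-bit false = here refl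
  every-bit true  = there (here refl)

cube-unique : (n : ℕ) → Unique (cube n)
cube-unique n = subst Unique (sym (cube≡vecsOver n)) (vecsOver-unique bits-unique n)
  where
  bits-unique : Unique (false ∷ true ∷ [])
  bits-unique = ((λ ()) ∷ []) ∷ [] ∷ []

module _ {A : Set} (_≟_ : DecidableEquality A) where

  any-single : (g : A → Bool) (L : List A) {i : A} → i ∈ L →
    (∀ {a} → a ≢ i → g a ≡ false) → any g L ≡ g i
  any-single g L {i} i∈L off with g i in gi
  ... | true  = any-true L i∈L
    where
    any-true : (M : List A) → i ∈ M → any g M ≡ true
    any-true (a ∷ M) (here refl) rewrite gi = refl
    any-true (a ∷ M) (there i∈M) rewrite any-true M i∈M = ∨-zeroʳ (g a)
  ... | false = any-false L
    where
    vanishes : ∀ a → g a ≡ false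
    vanishes a with a ≟ i
    ... | yes refl = gi
    ... | no  a≢i  = off a≢i
    any-false : (M : List A) → any g M ≡ false
    any-false []      = refl
    any-false (a ∷ M) rewrite vanishes a = any-false M

vec-ext : {A : Set} {n : ℕ} {u v : Vec A n} → (∀ i → lookup u i ≡ lookup v i) → u ≡ v
vec-ext {u = u} {v} same = trans (sym (tabulate∘lookup u)) (trans (tabulate-cong same) (tabulate∘lookup v))

InjectiveTable : {n : ℕ} → Vec (Fin n) n → Set
InjectiveTable {n} π = (i j : Fin n) → lookup π i ≡ lookup π j → i ≡ j

-- Pigeonhole: an injective self-map of Fin n is onto, since a missed value
-- would give an injection Fin (suc m) → Fin m.
injective⇒onto : {n : ℕ} (π : Vec (Fin n) n) → InjectiveTable π → (j : Fin n) → ∃ λ i → lookup π i ≡ j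
injective⇒onto {suc m} π π-inj j with any? (λ i → lookup π i ≟ᶠ j)
... | yes hit  = hit
... | no  miss = ⊥-elim (<⇒notInjective (n<1+n m) squeeze-injective)
  where
  squeeze : Fin (suc m) → Fin m
  squeeze i = punchOut {i = j} (λ j≡πi → miss (i , sym j≡πi))
  squeeze-injective : Injective _≡_ _≡_ squeeze
  squeeze-injective e = π-inj _ _ (punchOut-injective {i = j} _ _ e)

module _ {n : ℕ} where

  _∘ₜ_ : Vec (Fin n) n → Vec (Fin n) n → Vec (Fin n) n
  π ∘ₜ σ = tabulate (λ i → lookup π (lookup σ i))

  lookup-∘ₜ : (π σ : Vec (Fin n) n) (i : Fin n) → lookup (π ∘ₜ σ) i ≡ lookup π (lookup σ i)
  lookup-∘ₜ π σ = lookup∘tabulate _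

  ∘ₜ-cancel : (π ρ τ : Vec (Fin n) n) → (∀ i → lookup ρ (lookup τ i) ≡ i) → (π ∘ₜ ρ) ∘ₜ τ ≡ π
  ∘ₜ-cancel π ρ τ ρτ≡id = vec-ext λ i →
    trans (lookup-∘ₜ (π ∘ₜ ρ) τ i) (trans (lookup-∘ₜ π ρ (lookup τ i)) (cong (lookup π) (ρτ≡id i)))

  ∘ₜ-injective : (π σ : Vec (Fin n) n) → InjectiveTable π → InjectiveTable σ → InjectiveTable (π ∘ₜ σ)
  ∘ₜ-injective π σ π-inj σ-inj i j e =
    σ-inj i j (π-inj _ _ (trans (sym (lookup-∘ₜ π σ i)) (trans e (lookup-∘ₜ π σ j))))

  module _ (π : Vec (Fin n) n) (π-inj : InjectiveTable π) where

    inverse : Vec (Fin n) n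
    inverse = tabulate (λ j → proj₁ (injective⇒onto π π-inj j))

    inverseʳ : (j : Fin n) → lookup π (lookup inverse j) ≡ j
    inverseʳ j = trans (cong (lookup π) (lookup∘tabulate _ j)) (proj₂ (injective⇒onto π π-inj j))

    inverseˡ : (i : Fin n) → lookup inverse (lookup π i) ≡ i
    inverseˡ i = π-inj _ _ (inverseʳ (lookup π i))

    inverse-injective : InjectiveTable inverse
    inverse-injective i j e = trans (sym (inverseʳ i)) (trans (cong (lookup π) e) (inverseʳ j))

  module _ (π : Vec (Fin n) n) (π-inj : InjectiveTable π) where

    act-lookup : (x : Vec Bool n) (i : Fin n) → lookup (act π x) (lookup π i) ≡ lookup x i
    act-lookup x i = begin
      lookup (act π x) (lookup π i) ≡⟨ lookup∘tabulate _ (lookup π i) ⟩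
      any hits (allFin n)           ≡⟨ any-single _≟ᶠ_ hits (allFin n) (∈-allFin i) miss ⟩
      hits i                        ≡⟨ cong (_∧ lookup x i) (dec-true (lookup π i ≟ᶠ lookup π i) refl) ⟩
      lookup x i                    ∎
      where
      open ≡-Reasoning
      hits : Fin n → Bool
      hits k = does (lookup π k ≟ᶠ lookup π i) ∧ lookup x k
      miss : ∀ {k} → k ≢ i → hits k ≡ false
      miss k≢i = cong (_∧ _) (dec-false (_ ≟ᶠ _) (k≢i ∘ π-inj _ _))

    act-unique : (x y : Vec Bool n) → (∀ i → lookup y (lookup π i) ≡ lookup x i) → act π x ≡ y
    act-unique x y y-spec = vec-ext λ j →
      let (i , πi≡j) = injective⇒onto π π-inj j in
      subst (λ k → lookup (act π x) k ≡ lookup y k) πi≡j (trans (act-lookup x i) (sym (y-spec i)))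

  act-∘ₜ : (π σ : Vec (Fin n) n) → InjectiveTable π → InjectiveTable σ →
    (x : Vec Bool n) → act π (act σ x) ≡ act (π ∘ₜ σ) x
  act-∘ₜ π σ π-inj σ-inj x =
    sym (act-unique (π ∘ₜ σ) (∘ₜ-injective π σ π-inj σ-inj) x (act π (act σ x)) coordinates)
    where
    open ≡-Reasoning
    coordinates : ∀ i → lookup (act π (act σ x)) (lookup (π ∘ₜ σ) i) ≡ lookup x i
    coordinates i = begin
      lookup (act π (act σ x)) (lookup (π ∘ₜ σ) i)     ≡⟨ cong (lookup (act π (act σ x))) (lookup-∘ₜ π σ i) ⟩
      lookup (act π (act σ x)) (lookup π (lookup σ i)) ≡⟨ act-lookup π π-inj (act σ x) (lookup σ i) ⟩
      lookup (act σ x) (lookup σ i)                    ≡⟨ act-lookup σ σ-inj x i ⟩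
      lookup x i                                       ∎

  module _ (π : Vec (Fin n) n) (π-inj : InjectiveTable π) where

    act-inverseˡ : (x : Vec Bool n) → act (inverse π π-inj) (act π x) ≡ x
    act-inverseˡ x = act-unique (inverse π π-inj) (inverse-injective π π-inj) (act π x) x λ i →
      trans (sym (act-lookup π π-inj x (lookup (inverse π π-inj) i)))
            (cong (lookup (act π x)) (inverseʳ π π-inj i))

    act-inverseʳ : (x : Vec Bool n) → act π (act (inverse π π-inj) x) ≡ x
    act-inverseʳ x = act-unique π π-inj (act (inverse π π-inj) x) x λ i → sym (
      trans (cong (lookup (act (inverse π π-inj) x)) (sym (inverseˡ π π-inj i)))
            (act-lookup (inverse π π-inj) (inverse-injective π π-inj) x (lookup π i)))

∑cube-act : {n : ℕ} (π : Vec (Fin n) n) → InjectiveTable π →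
  (g : Vec Bool n → ℕ) → ∑ (cube n) (g ∘ act π) ≡ ∑ (cube n) g
∑cube-act {n} π π-inj =
  ∑-reindex (cube n) (cube-unique n) (act π) (act (inverse π π-inj))
    (λ _ → cube-complete n _) (λ _ → cube-complete n _)
    (act-inverseˡ π π-inj) (λ _ → act-inverseʳ π π-inj _)

module _ {n : ℕ} (J : Subset n) where

  ∘ₜ-IsSJ : (π σ : Vec (Fin n) n) → IsSJ J π → IsSJ J σ → IsSJ J (π ∘ₜ σ)
  ∘ₜ-IsSJ π σ (π-inj , π-fix) (σ-inj , σ-fix) = ∘ₜ-injective π σ π-inj σ-inj , λ i i∉J →
    trans (lookup-∘ₜ π σ i) (trans (cong (lookup π) (σ-fix i i∉J)) (π-fix i i∉J))

  inverse-IsSJ : (σ : Vec (Fin n) n) (σ∈ : IsSJ J σ) → IsSJ J (inverse σ (proj₁ σ∈))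
  inverse-IsSJ σ (σ-inj , σ-fix) = inverse-injective σ σ-inj , λ i i∉J →
    trans (cong (lookup (inverse σ σ-inj)) (sym (σ-fix i i∉J))) (inverseˡ σ σ-inj i)

  SJ-unique : Unique (SJ J)
  SJ-unique = Unique.filter⁺ (IsSJ? J) (vecsOver-unique (Unique.allFin⁺ n) n)

  IsSJ⇒∈SJ : {π : Vec (Fin n) n} → IsSJ J π → π ∈ SJ J
  IsSJ⇒∈SJ {π} = ∈-filter⁺ (IsSJ? J) (vecsOver-complete ∈-allFin n π)

  ∈SJ⇒IsSJ : {π : Vec (Fin n) n} → π ∈ SJ J → IsSJ J π
  ∈SJ⇒IsSJ π∈ = proj₂ (∈-filter⁻ (IsSJ? J) {xs = vecsOver (allFin n) n} π∈)

  ∑SJ-∘ₜ : (σ : Vec (Fin n) n) → IsSJ J σ →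
    (g : Vec (Fin n) n → ℕ) → ∑ (SJ J) (λ π → g (π ∘ₜ σ)) ≡ ∑ (SJ J) g
  ∑SJ-∘ₜ σ σ∈ =
    ∑-reindex (SJ J) SJ-unique (_∘ₜ σ) (_∘ₜ σ⁻¹)
      (λ {π} π∈ → IsSJ⇒∈SJ (∘ₜ-IsSJ π σ (∈SJ⇒IsSJ π∈) σ∈))
      (λ {π} π∈ → IsSJ⇒∈SJ (∘ₜ-IsSJ π σ⁻¹ (∈SJ⇒IsSJ π∈) (inverse-IsSJ σ σ∈)))
      (λ π → ∘ₜ-cancel π σ σ⁻¹ (inverseʳ σ (proj₁ σ∈)))
      (λ {π} _ → ∘ₜ-cancel π σ⁻¹ σ (inverseˡ σ (proj₁ σ∈)))
    where
    σ⁻¹ : Vec (Fin n) n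
    σ⁻¹ = inverse σ (proj₁ σ∈)

  orbitSum : (Vec Bool n → ℕ) → Vec Bool n → ℕ
  orbitSum g x = ∑ (SJ J) (λ π → g (act π x))

  orbitSum-symmetric : (g : Vec Bool n → ℕ) (x : Vec Bool n) (σ : Vec (Fin n) n) →
    IsSJ J σ → orbitSum g (act σ x) ≡ orbitSum g x
  orbitSum-symmetric g x σ σ∈ = begin
    ∑ (SJ J) (λ π → g (act π (act σ x))) ≡⟨ ∑-cong (SJ J) (λ {π} π∈ → cong g (act-∘ₜ π σ (proj₁ (∈SJ⇒IsSJ π∈)) (proj₁ σ∈) x)) ⟩
    ∑ (SJ J) (λ π → g (act (π ∘ₜ σ) x))  ≡⟨ ∑SJ-∘ₜ σ σ∈ (λ π → g (act π x)) ⟩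
    ∑ (SJ J) (λ π → g (act π x))         ∎
    where open ≡-Reasoning

  ∑-orbitSum : (g : Vec Bool n → ℕ) → ∑ (cube n) (orbitSum g) ≡ ∑ (cube n) g * sizeSJ J
  ∑-orbitSum g = begin
    ∑ (cube n) (λ x → ∑ (SJ J) (λ π → g (act π x))) ≡⟨ ∑-swap (cube n) (SJ J) _ ⟩
    ∑ (SJ J) (λ π → ∑ (cube n) (g ∘ act π))          ≡⟨ ∑-cong (SJ J) (λ {π} π∈ → ∑cube-act π (proj₁ (∈SJ⇒IsSJ π∈)) g) ⟩
    ∑ (SJ J) (λ _ → ∑ (cube n) g)                    ≡⟨ ∑-const (SJ J) _ ⟩
    sizeSJ J * ∑ (cube n) g                          ≡⟨ *-comm (sizeSJ J) _ ⟩
    ∑ (cube n) g * sizeSJ J                          ∎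
    where open ≡-Reasoning

module _ {n : ℕ} (f : Vec Bool n → Bool) (J : Subset n) where

  distCount-∑ : (g : Vec Bool n → Bool) → distCount f g ≡ ∑ (cube n) (λ x → differ (f x) (g x))
  distCount-∑ g = length-filter (λ x → ¬? (f x ≟ᵇ g x)) (cube n)

  symInfCount-∑ : symInfCount f J ≡ ∑ (cube n) (λ x → ∑ (SJ J) (λ π → differ (f x) (f (act π x))))
  symInfCount-∑ =
    trans (length-filter _ (cartesianProduct (cube n) (SJ J))) (∑-cartesianProduct (cube n) (SJ J) _)

  -- Upper bound, against any J-symmetric g: f x ≠ f (π x) forces f to disagree
  -- with g at x or at π x, because g (π x) = g x.
  symInfCount-upper : (g : Vec Bool n → Bool) → IsJSymmetric J g →
    symInfCount f J ≤ 2 * (distCount f g * sizeSJ J)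
  symInfCount-upper g g-symmetric = begin
    symInfCount f J                                         ≡⟨ symInfCount-∑ ⟩
    ∑ (cube n) (λ x → ∑ (SJ J) (λ π → differ (f x) (f (act π x))))
      ≤⟨ ∑-mono (cube n) (λ {x} _ → ∑-mono (SJ J) (λ {π} π∈ → through-g x π (∈SJ⇒IsSJ J π∈))) ⟩
    ∑ (cube n) (λ x → ∑ (SJ J) (λ π → D x + D (act π x)))
      ≡⟨ ∑-cong (cube n) (λ {x} _ → ∑-+ (SJ J) (λ _ → D x) (λ π → D (act π x))) ⟩
    ∑ (cube n) (λ x → ∑ (SJ J) (λ _ → D x) + orbitSum J D x)
      ≡⟨ ∑-+ (cube n) _ _ ⟩
    ∑ (cube n) (λ x → ∑ (SJ J) (λ _ → D x)) + ∑ (cube n) (orbitSum J D)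
      ≡⟨ cong₂ _+_ constant-in-π (trans (∑-orbitSum J D) D-total) ⟩
    d + d                                                   ≡⟨ cong (d +_) (+-identityʳ d) ⟨
    2 * d                                                   ∎
    where
    open ≤-Reasoning
    D : Vec Bool n → ℕ
    D x = differ (f x) (g x)
    d : ℕ
    d = distCount f g * sizeSJ J
    through-g : ∀ x π → IsSJ J π → differ (f x) (f (act π x)) ≤ D x + D (act π x)
    through-g x π π∈ rewrite g-symmetric x π π∈ = differ-triangle (f x) (f (act π x)) (g x)
    D-total : ∑ (cube n) D * sizeSJ J ≡ d
    D-total = cong (_* sizeSJ J) (sym (distCount-∑ g))
    constant-in-π : ∑ (cube n) (λ x → ∑ (SJ J) (λ _ → D x)) ≡ d
    constant-in-π = begin-equality
      ∑ (cube n) (λ x → ∑ (SJ J) (λ _ → D x)) ≡⟨ ∑-swap (cube n) (SJ J) _ ⟩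
      ∑ (SJ J) (λ _ → ∑ (cube n) D)            ≡⟨ ∑-const (SJ J) _ ⟩
      sizeSJ J * ∑ (cube n) D                  ≡⟨ *-comm (sizeSJ J) _ ⟩
      ∑ (cube n) D * sizeSJ J                  ≡⟨ D-total ⟩
      d                                        ∎

  mismatches : Vec Bool n → Bool → ℕ
  mismatches x b = orbitSum J (λ y → differ (f y) b) x

  majority : Vec Bool n → Bool
  majority x = does (mismatches x true ≤? mismatches x false)

  majority-symmetric : IsJSymmetric J majority
  majority-symmetric x σ σ∈ = cong₂ (λ u v → does (u ≤? v)) (invariant true) (invariant false)
    where
    invariant : ∀ b → mismatches (act σ x) b ≡ mismatches x b
    invariant b = orbitSum-symmetric J (λ y → differ (f y) b) x σ σ∈

  -- Lower bound: on each orbit the majority vote disagrees with f (π x) no more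
  -- often than f x does, and averaging over orbits turns this into dist(f, majority).
  symInfCount-lower : distCount f majority * sizeSJ J ≤ symInfCount f J
  symInfCount-lower = begin
    distCount f majority * sizeSJ J             ≡⟨ cong (_* sizeSJ J) (distCount-∑ majority) ⟩
    ∑ (cube n) D * sizeSJ J                     ≡⟨ ∑-orbitSum J D ⟨
    ∑ (cube n) (orbitSum J D)
      ≡⟨ ∑-cong (cube n) (λ {x} _ → ∑-cong (SJ J) (λ {π} π∈ →
           cong (differ (f (act π x))) (majority-symmetric x π (∈SJ⇒IsSJ J π∈)))) ⟩
    ∑ (cube n) (λ x → mismatches x (majority x))
      ≤⟨ ∑-mono (cube n) (λ {x} _ → bool-argmin (mismatches x) (mismatches x true ≤? mismatches x false) (f x)) ⟩
    ∑ (cube n) (λ x → mismatches x (f x))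
      ≡⟨ ∑-cong (cube n) (λ {x} _ → ∑-cong (SJ J) (λ {π} _ → differ-sym (f (act π x)) (f x))) ⟩
    ∑ (cube n) (λ x → ∑ (SJ J) (λ π → differ (f x) (f (act π x)))) ≡⟨ symInfCount-∑ ⟨
    symInfCount f J                             ∎
    where
    open ≤-Reasoning
    D : Vec Bool n → ℕ
    D x = differ (f x) (majority x)

lemma3 : (n : ℕ) (f : Vec Bool n → Bool) (J : Subset n) (fJ : Vec Bool n → Bool) →
    IsJSymmetric J fJ →
    ((h : Vec Bool n → Bool) → IsJSymmetric J h → distCount f fJ ≤ distCount f h) →
    (distCount f fJ * sizeSJ J ≤ symInfCount f J) ×
    (symInfCount f J ≤ 2 * (distCount f fJ * sizeSJ J))
lemma3 n f J fJ fJ-symmetric fJ-closest =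
  ≤-trans (*-monoˡ-≤ (sizeSJ J) (fJ-closest (majority f J) (majority-symmetric f J)))
          (symInfCount-lower f J)
  , symInfCount-upper f J fJ fJ-symmetric
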